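{- Let $n$ be a non-negative integer, $k$ an even integer and $r$ any integer. Then $$2\sum_{j=0}^n j\binom{n}{j}L_{r+2kj}=5nL_k^{n-1}F_{r+nk}F_k+nL_k^nL_{r+nk},$$ $$2\sum_{j=0}^n j\binom{n}{j}F_{r+2kj}=nL_k^{n-1}L_{r+nk}F_k+nL_k^nF_{r+nk}.$$
   Context: $F_j$ and $L_j$ denote the Fibonacci and Lucas numbers, defined for all integers $j$ by $F_j=(\alpha^j-\beta^j)/(\alpha-\beta)$, $L_j=\alpha^j+\beta^j$, with $\alpha=(1+\sqrt5)/2$, $\beta=(1-\sqrt5)/2$. -}

module Defs where

open import Data.Nat as ℕ using (ℕ; zero; suc)
open import Data.Integer using (ℤ; +_; -[1+_]; _+_; _*_; -_)

fibℕ : ℕ → ℤ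
fibℕ 0 = + 0
fibℕ 1 = + 1
fibℕ (suc (suc n)) = fibℕ (suc n) + fibℕ n

lucℕ : ℕ → ℤ
lucℕ 0 = + 2
lucℕ 1 = + 1
lucℕ (suc (suc n)) = lucℕ (suc n) + lucℕ n

sgn : ℕ → ℤ
sgn zero = + 1
sgn (suc m) = - sgn m

-- Extension to all integer indices (consistent with the Binet formulas):
-- F_{-m} = (-1)^{m+1} F_m,  L_{-m} = (-1)^m L_m
F : ℤ → ℤ
F (+ m) = fibℕ m
F -[1+ m ] = sgn (suc (suc m)) * fibℕ (suc m)

L : ℤ → ℤ
L (+ m) = lucℕ m
L -[1+ m ] = sgn (suc m) * lucℕ (suc m)

sumTo : ℕ → (ℕ → ℤ) → ℤ
sumTo zero f = f 0
sumTo (suc n) f = sumTo n f + f (suc n)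

-- Every two-sided sequence satisfying u(x+2) = u(x+1) + u(x) is determined by two
-- consecutive values; this yields the addition formulas 2F(m+k) = F m L k + L m F k and
-- 2L(m+k) = L m L k + 5 F m F k, and from them the k-step recurrence
-- g(x+2k) + (-1)^k g(x) = L_k g(x+k) for g = F, L. For even k, Pascal's rule and induction
-- on n turn this recurrence into  Σ C(n,j) g(r+2kj) = L_k^n g(r+nk), and the absorption
-- identity j C(n,j) = n C(n-1,j-1) reduces the weighted sum to n L_k^(n-1) g(r+nk+k),
-- which the addition formulas expand into the stated right-hand sides.
module Submission where

open import Defs
open import Data.Nat as ℕ using (ℕ; zero; suc; _∸_)
import Data.Nat.Properties as ℕ
open import Data.Nat.Combinatorics using (_C_; nC1≡n; nCk+nC[k+1]≡[n+1]C[k+1])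
open import Data.Nat.Combinatorics.Specification using (k>n⇒nCk≡0)
open import Data.Integer using (ℤ; +_; -[1+_]; _+_; _*_; _^_; -_; _-_; ∣_∣)
open import Data.Integer.Properties
open import Data.Integer.Tactic.RingSolver using (solve-∀)
open import Algebra.Properties.AbelianGroup +-0-abelianGroup using (∙-cancelˡ)
open import Data.Product using (_×_; _,_; proj₁; ∃)
open import Relation.Binary.PropositionalEquality
open ≡-Reasoning

nC[1+n]≡0 : ∀ n → n C suc n ≡ 0
nC[1+n]≡0 n = k>n⇒nCk≡0 (ℕ.n<1+n n)

[k+1]*[n+1]C[k+1]≡[n+1]*nCk : ∀ n k → suc k ℕ.* (suc n C suc k) ≡ suc n ℕ.* (n C k)
[k+1]*[n+1]C[k+1]≡[n+1]*nCk zero zero = refl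
[k+1]*[n+1]C[k+1]≡[n+1]*nCk zero (suc k)
  rewrite k>n⇒nCk≡0 {1} {suc (suc k)} (ℕ.s≤s (ℕ.s≤s ℕ.z≤n))
        | k>n⇒nCk≡0 {0} {suc k} (ℕ.s≤s ℕ.z≤n) = ℕ.*-zeroʳ (suc (suc k))
[k+1]*[n+1]C[k+1]≡[n+1]*nCk (suc n) zero =
  trans (ℕ.*-identityˡ _) (trans (nC1≡n (suc (suc n))) (sym (ℕ.*-identityʳ _)))
[k+1]*[n+1]C[k+1]≡[n+1]*nCk (suc n) (suc k) = begin
  suc (suc k) ℕ.* (suc (suc n) C suc (suc k))
    ≡⟨ cong (suc (suc k) ℕ.*_) (sym (nCk+nC[k+1]≡[n+1]C[k+1] (suc n) (suc k))) ⟩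
  suc (suc k) ℕ.* (a ℕ.+ b)
    ≡⟨ ℕ.*-distribˡ-+ (suc (suc k)) a b ⟩
  (a ℕ.+ suc k ℕ.* a) ℕ.+ suc (suc k) ℕ.* b
    ≡⟨ cong₂ (λ p q → (a ℕ.+ p) ℕ.+ q) ([k+1]*[n+1]C[k+1]≡[n+1]*nCk n k)
                                         ([k+1]*[n+1]C[k+1]≡[n+1]*nCk n (suc k)) ⟩
  (a ℕ.+ suc n ℕ.* (n C k)) ℕ.+ suc n ℕ.* (n C suc k)
    ≡⟨ ℕ.+-assoc a _ _ ⟩
  a ℕ.+ (suc n ℕ.* (n C k) ℕ.+ suc n ℕ.* (n C suc k))
    ≡⟨ cong (a ℕ.+_) (sym (ℕ.*-distribˡ-+ (suc n) (n C k) (n C suc k))) ⟩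
  a ℕ.+ suc n ℕ.* (n C k ℕ.+ n C suc k)
    ≡⟨ cong (λ z → a ℕ.+ suc n ℕ.* z) (nCk+nC[k+1]≡[n+1]C[k+1] n k) ⟩
  a ℕ.+ suc n ℕ.* a ∎
  where
  a = suc n C suc k
  b = suc n C suc (suc k)

n*c^n≡n*c^[n∸1]*c : ∀ n (c : ℤ) → + n * c ^ n ≡ + n * c ^ (n ∸ 1) * c
n*c^n≡n*c^[n∸1]*c zero c = refl
n*c^n≡n*c^[n∸1]*c (suc n) c =
  trans (cong (+ suc n *_) (*-comm c (c ^ n))) (sym (*-assoc (+ suc n) (c ^ n) c))

sumTo-cong : ∀ n {f g : ℕ → ℤ} → (∀ j → f j ≡ g j) → sumTo n f ≡ sumTo n g
sumTo-cong zero    f≡g = f≡g 0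
sumTo-cong (suc n) f≡g = cong₂ _+_ (sumTo-cong n f≡g) (f≡g (suc n))

sumTo-+ : ∀ n (f g : ℕ → ℤ) → sumTo n (λ j → f j + g j) ≡ sumTo n f + sumTo n g
sumTo-+ zero    f g = refl
sumTo-+ (suc n) f g = trans (cong (_+ (f (suc n) + g (suc n))) (sumTo-+ n f g))
                            (interchange (sumTo n f) (sumTo n g) (f (suc n)) (g (suc n)))
  where interchange : ∀ a b c d → (a + b) + (c + d) ≡ (a + c) + (b + d)
        interchange = solve-∀

sumTo-*ˡ : ∀ n c (f : ℕ → ℤ) → sumTo n (λ j → c * f j) ≡ c * sumTo n f
sumTo-*ˡ zero    c f = refl
sumTo-*ˡ (suc n) c f = trans (cong (_+ (c * f (suc n))) (sumTo-*ˡ n c f)) (sym (*-distribˡ-+ c _ _))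

sumTo-suc-head : ∀ n (f : ℕ → ℤ) → sumTo (suc n) f ≡ f 0 + sumTo n (λ j → f (suc j))
sumTo-suc-head zero    f = refl
sumTo-suc-head (suc n) f = trans (cong (_+ f (suc (suc n))) (sumTo-suc-head n f)) (+-assoc (f 0) _ _)

sumTo-pascal : ∀ n (h : ℕ → ℤ) →
  sumTo (suc n) (λ j → + (suc n C j) * h j)
  ≡ sumTo n (λ j → + (n C j) * h j) + sumTo n (λ j → + (n C j) * h (suc j))
sumTo-pascal n h = begin
  sumTo (suc n) (λ j → + (suc n C j) * h j)
    ≡⟨ sumTo-suc-head n _ ⟩
  h₀ + sumTo n (λ j → + (suc n C suc j) * h (suc j))
    ≡⟨ cong (λ s → h₀ + s) (sumTo-cong n pascal) ⟩
  h₀ + sumTo n (λ j → + (n C j) * h (suc j) + + (n C suc j) * h (suc j))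
    ≡⟨ cong (λ s → h₀ + s) (sumTo-+ n _ _) ⟩
  h₀ + (S′ + sumTo n (λ j → g (suc j)))
    ≡⟨ swap h₀ S′ _ ⟩
  (h₀ + sumTo n (λ j → g (suc j))) + S′
    ≡⟨ cong (_+ S′) (sym (sumTo-suc-head n g)) ⟩
  (sumTo n g + + (n C suc n) * h (suc n)) + S′
    ≡⟨ cong (λ c → (sumTo n g + + c * h (suc n)) + S′) (nC[1+n]≡0 n) ⟩
  (sumTo n g + + 0) + S′
    ≡⟨ cong (_+ S′) (+-identityʳ (sumTo n g)) ⟩
  sumTo n g + S′ ∎
  where
  h₀ = + 1 * h 0
  g : ℕ → ℤ
  g j = + (n C j) * h j
  S′ = sumTo n (λ j → + (n C j) * h (suc j))
  pascal : ∀ j → + (suc n C suc j) * h (suc j) ≡ + (n C j) * h (suc j) + + (n C suc j) * h (suc j)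
  pascal j = trans (cong (λ c → + c * h (suc j)) (sym (nCk+nC[k+1]≡[n+1]C[k+1] n j)))
                   (*-distribʳ-+ (h (suc j)) (+ (n C j)) (+ (n C suc j)))
  swap : ∀ a s t → a + (s + t) ≡ (a + t) + s
  swap = solve-∀

ℤ-induction : (P : ℤ → Set) → P (+ 0) →
  (∀ x → P x → P (+ 1 + x)) → (∀ x → P (+ 1 + x) → P x) → ∀ x → P x
ℤ-induction P p₀ up down (+ zero)     = p₀
ℤ-induction P p₀ up down (+ suc n)    = up (+ n) (ℤ-induction P p₀ up down (+ n))
ℤ-induction P p₀ up down -[1+ zero ]  = down -[1+ 0 ] p₀
ℤ-induction P p₀ up down -[1+ suc n ] = down -[1+ suc n ] (ℤ-induction P p₀ up down -[1+ n ])

record FibonacciLike (u : ℤ → ℤ) : Set where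
  field recurrence : ∀ x → u (+ 2 + x) ≡ u (+ 1 + x) + u x

open FibonacciLike

fibonacciLike-ext : ∀ {u v} → FibonacciLike u → FibonacciLike v →
  u (+ 0) ≡ v (+ 0) → u (+ 1) ≡ v (+ 1) → ∀ x → u x ≡ v x
fibonacciLike-ext {u} {v} rec-u rec-v u₀≡v₀ u₁≡v₁ x =
  proj₁ (ℤ-induction Agree (u₀≡v₀ , u₁≡v₁) up down x)
  where
  Agree : ℤ → Set
  Agree x = u x ≡ v x × u (+ 1 + x) ≡ v (+ 1 + x)
  2+x≡1+[1+x] : ∀ x → + 2 + x ≡ + 1 + (+ 1 + x)
  2+x≡1+[1+x] = +-assoc (+ 1) (+ 1)
  up : ∀ x → Agree x → Agree (+ 1 + x)
  up x (eq₀ , eq₁) = eq₁ , (begin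
    u (+ 1 + (+ 1 + x)) ≡⟨ cong u (sym (2+x≡1+[1+x] x)) ⟩
    u (+ 2 + x)         ≡⟨ trans (recurrence rec-u x) (cong₂ _+_ eq₁ eq₀) ⟩
    v (+ 1 + x) + v x   ≡⟨ sym (recurrence rec-v x) ⟩
    v (+ 2 + x)         ≡⟨ cong v (2+x≡1+[1+x] x) ⟩
    v (+ 1 + (+ 1 + x)) ∎)
  down : ∀ x → Agree (+ 1 + x) → Agree x
  down x (eq₁ , eq₂) = ∙-cancelˡ (u (+ 1 + x)) (u x) (v x) (begin
    u (+ 1 + x) + u x   ≡⟨ sym (recurrence rec-u x) ⟩
    u (+ 2 + x)         ≡⟨ cong u (2+x≡1+[1+x] x) ⟩
    u (+ 1 + (+ 1 + x)) ≡⟨ eq₂ ⟩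
    v (+ 1 + (+ 1 + x)) ≡⟨ cong v (sym (2+x≡1+[1+x] x)) ⟩
    v (+ 2 + x)         ≡⟨ recurrence rec-v x ⟩
    v (+ 1 + x) + v x   ≡⟨ cong (_+ v x) (sym eq₁) ⟩
    u (+ 1 + x) + v x   ∎) , eq₁

fibonacciLike-shift : ∀ {u} m → FibonacciLike u → FibonacciLike (λ x → u (m + x))
recurrence (fibonacciLike-shift {u} m rec) x = begin
  u (m + (+ 2 + x))               ≡⟨ cong u (comm₂ m x) ⟩
  u (+ 2 + (m + x))               ≡⟨ recurrence rec (m + x) ⟩
  u (+ 1 + (m + x)) + u (m + x)   ≡⟨ cong (λ y → u y + u (m + x)) (sym (comm₁ m x)) ⟩
  u (m + (+ 1 + x)) + u (m + x)   ∎
  where comm₂ : ∀ m x → m + (+ 2 + x) ≡ + 2 + (m + x)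
        comm₂ = solve-∀
        comm₁ : ∀ m x → m + (+ 1 + x) ≡ + 1 + (m + x)
        comm₁ = solve-∀

fibonacciLike-+ : ∀ {u v} → FibonacciLike u → FibonacciLike v →
  FibonacciLike (λ x → u x + v x)
recurrence (fibonacciLike-+ {u} {v} rec-u rec-v) x =
  trans (cong₂ _+_ (recurrence rec-u x) (recurrence rec-v x))
        (interchange (u (+ 1 + x)) (u x) (v (+ 1 + x)) (v x))
  where interchange : ∀ a b c d → (a + b) + (c + d) ≡ (a + c) + (b + d)
        interchange = solve-∀

fibonacciLike-*ˡ : ∀ {u} a → FibonacciLike u → FibonacciLike (λ x → a * u x)
recurrence (fibonacciLike-*ˡ a rec) x = trans (cong (a *_) (recurrence rec x)) (*-distribˡ-+ a _ _)

F-fibonacciLike : FibonacciLike F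
recurrence F-fibonacciLike (+ n)              = refl
recurrence F-fibonacciLike -[1+ zero ]        = refl
recurrence F-fibonacciLike -[1+ suc zero ]    = refl
recurrence F-fibonacciLike -[1+ suc (suc n) ] = identity (sgn n) (fibℕ (suc (suc n))) (fibℕ (suc n))
  where identity : ∀ s a b → (- - s) * b ≡ (- - - s) * a + (- - - - s) * (a + b)
        identity = solve-∀

L-fibonacciLike : FibonacciLike L
recurrence L-fibonacciLike (+ n)              = refl
recurrence L-fibonacciLike -[1+ zero ]        = refl
recurrence L-fibonacciLike -[1+ suc zero ]    = refl
recurrence L-fibonacciLike -[1+ suc (suc n) ] = identity (sgn n) (lucℕ (suc (suc n))) (lucℕ (suc n))
  where identity : ∀ s a b → (- s) * b ≡ (- - s) * a + (- - - s) * (a + b)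
        identity = solve-∀

2*F[1+m]≡Fm+Lm : ∀ m → + 2 * F (+ 1 + m) ≡ F m + L m
2*F[1+m]≡Fm+Lm = fibonacciLike-ext
  (fibonacciLike-*ˡ (+ 2) (fibonacciLike-shift (+ 1) F-fibonacciLike))
  (fibonacciLike-+ F-fibonacciLike L-fibonacciLike) refl refl

2*L[1+m]≡Lm+5Fm : ∀ m → + 2 * L (+ 1 + m) ≡ L m + + 5 * F m
2*L[1+m]≡Lm+5Fm = fibonacciLike-ext
  (fibonacciLike-*ˡ (+ 2) (fibonacciLike-shift (+ 1) L-fibonacciLike))
  (fibonacciLike-+ L-fibonacciLike (fibonacciLike-*ˡ (+ 5) F-fibonacciLike)) refl refl

F-+ : ∀ m k → + 2 * F (m + k) ≡ F m * L k + L m * F k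
F-+ m = fibonacciLike-ext
  (fibonacciLike-*ˡ (+ 2) (fibonacciLike-shift m F-fibonacciLike))
  (fibonacciLike-+ (fibonacciLike-*ˡ (F m) L-fibonacciLike)
                   (fibonacciLike-*ˡ (L m) F-fibonacciLike))
  (trans (cong (λ y → + 2 * F y) (+-identityʳ m)) (at0 (F m) (L m)))
  (trans (cong (λ y → + 2 * F y) (+-comm m (+ 1))) (trans (2*F[1+m]≡Fm+Lm m) (at1 (F m) (L m))))
  where at0 : ∀ a b → + 2 * a ≡ a * + 2 + b * + 0
        at0 = solve-∀
        at1 : ∀ a b → a + b ≡ a * + 1 + b * + 1
        at1 = solve-∀

L-+ : ∀ m k → + 2 * L (m + k) ≡ L m * L k + + 5 * F m * F k
L-+ m = fibonacciLike-ext
  (fibonacciLike-*ˡ (+ 2) (fibonacciLike-shift m L-fibonacciLike))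
  (fibonacciLike-+ (fibonacciLike-*ˡ (L m) L-fibonacciLike)
                   (fibonacciLike-*ˡ (+ 5 * F m) F-fibonacciLike))
  (trans (cong (λ y → + 2 * L y) (+-identityʳ m)) (at0 (L m) (F m)))
  (trans (cong (λ y → + 2 * L y) (+-comm m (+ 1))) (trans (2*L[1+m]≡Lm+5Fm m) (at1 (L m) (F m))))
  where at0 : ∀ a b → + 2 * a ≡ a * + 2 + + 5 * b * + 0
        at0 = solve-∀
        at1 : ∀ a b → a + + 5 * b ≡ a * + 1 + + 5 * b * + 1
        at1 = solve-∀

sgn-+ : ∀ a b → sgn (a ℕ.+ b) ≡ sgn a * sgn b
sgn-+ zero    b = sym (*-identityˡ _)
sgn-+ (suc a) b = trans (cong -_ (sgn-+ a b)) (neg-distribˡ-* (sgn a) (sgn b))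

sgn[a]*sgn[a]≡1 : ∀ a → sgn a * sgn a ≡ + 1
sgn[a]*sgn[a]≡1 zero    = refl
sgn[a]*sgn[a]≡1 (suc a) = trans (neg*neg (sgn a)) (sgn[a]*sgn[a]≡1 a)
  where neg*neg : ∀ s → (- s) * (- s) ≡ s * s
        neg*neg = solve-∀

sgn∣2*m∣≡1 : ∀ m → sgn ∣ + 2 * m ∣ ≡ + 1
sgn∣2*m∣≡1 m = begin
  sgn ∣ + 2 * m ∣               ≡⟨ cong sgn (abs-* (+ 2) m) ⟩
  sgn (∣ m ∣ ℕ.+ (∣ m ∣ ℕ.+ 0)) ≡⟨ cong (λ a → sgn (∣ m ∣ ℕ.+ a)) (ℕ.+-identityʳ ∣ m ∣) ⟩
  sgn (∣ m ∣ ℕ.+ ∣ m ∣)         ≡⟨ sgn-+ ∣ m ∣ ∣ m ∣ ⟩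
  sgn ∣ m ∣ * sgn ∣ m ∣         ≡⟨ sgn[a]*sgn[a]≡1 ∣ m ∣ ⟩
  + 1                           ∎

F-neg : ∀ x → F (- x) ≡ - (sgn ∣ x ∣ * F x)
F-neg (+ zero)  = refl
F-neg (+ suc n) = identity (sgn n) (fibℕ (suc n))
  where identity : ∀ s f → (- - s) * f ≡ - ((- s) * f)
        identity = solve-∀
F-neg -[1+ n ]  = begin
  fibℕ (suc n)                                ≡⟨ sym (*-identityˡ _) ⟩
  + 1 * fibℕ (suc n)                          ≡⟨ cong (_* fibℕ (suc n)) (sym (sgn[a]*sgn[a]≡1 n)) ⟩
  sgn n * sgn n * fibℕ (suc n)                ≡⟨ identity (sgn n) (fibℕ (suc n)) ⟩
  - ((- sgn n) * ((- - sgn n) * fibℕ (suc n))) ∎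
  where identity : ∀ s f → s * s * f ≡ - ((- s) * ((- - s) * f))
        identity = solve-∀

L-neg : ∀ x → L (- x) ≡ sgn ∣ x ∣ * L x
L-neg (+ zero)  = refl
L-neg (+ suc n) = refl
L-neg -[1+ n ]  = begin
  lucℕ (suc n)                                ≡⟨ sym (*-identityˡ _) ⟩
  + 1 * lucℕ (suc n)
    ≡⟨ cong (_* lucℕ (suc n)) (sym (sgn[a]*sgn[a]≡1 (suc n))) ⟩
  sgn (suc n) * sgn (suc n) * lucℕ (suc n)    ≡⟨ *-assoc (sgn (suc n)) _ _ ⟩
  sgn (suc n) * (sgn (suc n) * lucℕ (suc n))  ∎

F-− : ∀ y k → + 2 * F (y - k) ≡ sgn ∣ k ∣ * (F y * L k - L y * F k)
F-− y k = begin
  + 2 * F (y - k)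
    ≡⟨ F-+ y (- k) ⟩
  F y * L (- k) + L y * F (- k)
    ≡⟨ cong₂ (λ a b → F y * a + L y * b) (L-neg k) (F-neg k) ⟩
  F y * (sgn ∣ k ∣ * L k) + L y * - (sgn ∣ k ∣ * F k)
    ≡⟨ identity (sgn ∣ k ∣) (F y) (L k) (L y) (F k) ⟩
  sgn ∣ k ∣ * (F y * L k - L y * F k) ∎
  where identity : ∀ s a b c d → a * (s * b) + c * - (s * d) ≡ s * (a * b - c * d)
        identity = solve-∀

L-− : ∀ y k → + 2 * L (y - k) ≡ sgn ∣ k ∣ * (L y * L k - + 5 * F y * F k)
L-− y k = begin
  + 2 * L (y - k)
    ≡⟨ L-+ y (- k) ⟩
  L y * L (- k) + + 5 * F y * F (- k)
    ≡⟨ cong₂ (λ a b → L y * a + + 5 * F y * b) (L-neg k) (F-neg k) ⟩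
  L y * (sgn ∣ k ∣ * L k) + + 5 * F y * - (sgn ∣ k ∣ * F k)
    ≡⟨ identity (sgn ∣ k ∣) (L y) (L k) (F y) (F k) ⟩
  sgn ∣ k ∣ * (L y * L k - + 5 * F y * F k) ∎
  where identity : ∀ s a b c d → a * (s * b) + + 5 * c * - (s * d) ≡ s * (a * b - + 5 * c * d)
        identity = solve-∀

±-formulas⇒k-step : ∀ (g a b : ℤ → ℤ) k →
  (∀ y → + 2 * g (y + k) ≡ a y + b y) →
  (∀ y → + 2 * g (y - k) ≡ sgn ∣ k ∣ * (a y - b y)) →
  ∀ x → g (x + + 2 * k) + sgn ∣ k ∣ * g x ≡ a (x + k)
±-formulas⇒k-step g a b k g-+ g-− x = *-cancelˡ-≡ (+ 2) _ _ (begin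
  + 2 * (g (x + + 2 * k) + s * g x)
    ≡⟨ cong₂ (λ p q → + 2 * (g p + s * g q)) (x+2k≡y+k x k) (x≡y-k x k) ⟩
  + 2 * (g (y + k) + s * g (y - k))
    ≡⟨ distrib s (g (y + k)) (g (y - k)) ⟩
  + 2 * g (y + k) + s * (+ 2 * g (y - k))
    ≡⟨ cong₂ (λ p q → p + s * q) (g-+ y) (g-− y) ⟩
  (a y + b y) + s * (s * (a y - b y))
    ≡⟨ collapse s (a y) (b y) ⟩
  (+ 1 + s * s) * a y + (+ 1 - s * s) * b y
    ≡⟨ cong (λ t → (+ 1 + t) * a y + (+ 1 - t) * b y) (sgn[a]*sgn[a]≡1 ∣ k ∣) ⟩
  (+ 1 + + 1) * a y + (+ 1 - + 1) * b y
    ≡⟨ simplify (a y) (b y) ⟩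
  + 2 * a y ∎)
  where
  s = sgn ∣ k ∣
  y = x + k
  x+2k≡y+k : ∀ x k → x + + 2 * k ≡ (x + k) + k
  x+2k≡y+k = solve-∀
  x≡y-k : ∀ x k → x ≡ (x + k) - k
  x≡y-k = solve-∀
  distrib : ∀ s p q → + 2 * (p + s * q) ≡ + 2 * p + s * (+ 2 * q)
  distrib = solve-∀
  collapse : ∀ s a b → (a + b) + s * (s * (a - b)) ≡ (+ 1 + s * s) * a + (+ 1 - s * s) * b
  collapse = solve-∀
  simplify : ∀ a b → (+ 1 + + 1) * a + (+ 1 - + 1) * b ≡ + 2 * a
  simplify = solve-∀

F-k-step : ∀ k x → F (x + + 2 * k) + sgn ∣ k ∣ * F x ≡ L k * F (x + k)
F-k-step k x = trans
  (±-formulas⇒k-step F (λ y → F y * L k) (λ y → L y * F k) k (λ y → F-+ y k) (λ y → F-− y k) x)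
  (*-comm (F (x + k)) (L k))

L-k-step : ∀ k x → L (x + + 2 * k) + sgn ∣ k ∣ * L x ≡ L k * L (x + k)
L-k-step k x = trans
  (±-formulas⇒k-step L (λ y → L y * L k) (λ y → + 5 * F y * F k) k (λ y → L-+ y k) (λ y → L-− y k) x)
  (*-comm (L (x + k)) (L k))

k-step-even : ∀ (g : ℤ → ℤ) {k} m c → k ≡ + 2 * m →
  (∀ x → g (x + + 2 * k) + sgn ∣ k ∣ * g x ≡ c * g (x + k)) →
  ∀ x → g (x + + 2 * k) + g x ≡ c * g (x + k)
k-step-even g {k} m c k≡2m k-step x =
  trans (cong (λ t → g (x + + 2 * k) + t) g[x]≡sgn∣k∣*g[x]) (k-step x)
  where g[x]≡sgn∣k∣*g[x] : g x ≡ sgn ∣ k ∣ * g x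
        g[x]≡sgn∣k∣*g[x] = sym (begin
          sgn ∣ k ∣ * g x         ≡⟨ cong (λ k → sgn ∣ k ∣ * g x) k≡2m ⟩
          sgn ∣ + 2 * m ∣ * g x   ≡⟨ cong (_* g x) (sgn∣2*m∣≡1 m) ⟩
          + 1 * g x               ≡⟨ *-identityˡ (g x) ⟩
          g x                     ∎)

module _ (g : ℤ → ℤ) (k c : ℤ) (step : ∀ x → g (x + + 2 * k) + g x ≡ c * g (x + k)) where

  binomial-sum : ∀ n r →
    sumTo n (λ j → + (n C j) * g (r + + 2 * k * + j)) ≡ c ^ n * g (r + + n * k)
  binomial-sum zero    r = cong (λ z → + 1 * g z) (r+2k*0≡r+0*k r k)
    where r+2k*0≡r+0*k : ∀ r k → r + + 2 * k * + 0 ≡ r + + 0 * k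
          r+2k*0≡r+0*k = solve-∀
  binomial-sum (suc n) r = begin
    sumTo (suc n) (λ j → + (suc n C j) * g (r + + 2 * k * + j))
      ≡⟨ sumTo-pascal n (λ j → g (r + + 2 * k * + j)) ⟩
    S r + sumTo n (λ j → + (n C j) * g (r + + 2 * k * + suc j))
      ≡⟨ cong (λ t → S r + t) (sumTo-cong n λ j → cong (λ z → + (n C j) * g z) (shift r k (+ j))) ⟩
    S r + S (r + + 2 * k)
      ≡⟨ cong₂ _+_ (binomial-sum n r) (binomial-sum n (r + + 2 * k)) ⟩
    c ^ n * g y + c ^ n * g ((r + + 2 * k) + + n * k)
      ≡⟨ cong (λ z → c ^ n * g y + c ^ n * g z) (reorder r k (+ n)) ⟩
    c ^ n * g y + c ^ n * g (y + + 2 * k)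
      ≡⟨ sym (*-distribˡ-+ (c ^ n) _ _) ⟩
    c ^ n * (g y + g (y + + 2 * k))
      ≡⟨ cong (c ^ n *_) (trans (+-comm (g y) _) (step y)) ⟩
    c ^ n * (c * g (y + k))
      ≡⟨ cong (λ z → c ^ n * (c * g z)) (collect r k (+ n)) ⟩
    c ^ n * (c * g (r + + suc n * k))
      ≡⟨ rotate (c ^ n) c _ ⟩
    c * c ^ n * g (r + + suc n * k) ∎
    where
    S : ℤ → ℤ
    S r = sumTo n (λ j → + (n C j) * g (r + + 2 * k * + j))
    y = r + + n * k
    shift : ∀ r k j → r + + 2 * k * (+ 1 + j) ≡ (r + + 2 * k) + + 2 * k * j
    shift = solve-∀
    reorder : ∀ r k n → (r + + 2 * k) + n * k ≡ (r + n * k) + + 2 * k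
    reorder = solve-∀
    collect : ∀ r k n → (r + n * k) + k ≡ r + (+ 1 + n) * k
    collect = solve-∀
    rotate : ∀ a b d → a * (b * d) ≡ b * a * d
    rotate = solve-∀

  weighted-binomial-sum : ∀ n r →
    sumTo n (λ j → + j * + (n C j) * g (r + + 2 * k * + j))
    ≡ + n * c ^ (n ∸ 1) * g (r + + n * k + k)
  weighted-binomial-sum zero    r = refl
  weighted-binomial-sum (suc m) r = begin
    sumTo (suc m) (λ j → + j * + (suc m C j) * g (r + + 2 * k * + j))
      ≡⟨ sumTo-suc-head m _ ⟩
    + 0 + sumTo m (λ j → + suc j * + (suc m C suc j) * g (r + + 2 * k * + suc j))
      ≡⟨ +-identityˡ _ ⟩
    sumTo m (λ j → + suc j * + (suc m C suc j) * g (r + + 2 * k * + suc j))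
      ≡⟨ sumTo-cong m absorb ⟩
    sumTo m (λ j → + suc m * (+ (m C j) * g ((r + + 2 * k) + + 2 * k * + j)))
      ≡⟨ sumTo-*ˡ m (+ suc m) _ ⟩
    + suc m * sumTo m (λ j → + (m C j) * g ((r + + 2 * k) + + 2 * k * + j))
      ≡⟨ cong (+ suc m *_) (binomial-sum m (r + + 2 * k)) ⟩
    + suc m * (c ^ m * g ((r + + 2 * k) + + m * k))
      ≡⟨ cong (λ z → + suc m * (c ^ m * g z)) (collect r k (+ m)) ⟩
    + suc m * (c ^ m * g (r + + suc m * k + k))
      ≡⟨ sym (*-assoc (+ suc m) (c ^ m) _) ⟩
    + suc m * c ^ m * g (r + + suc m * k + k) ∎
    where
    shift : ∀ r k j → r + + 2 * k * (+ 1 + j) ≡ (r + + 2 * k) + + 2 * k * j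
    shift = solve-∀
    collect : ∀ r k m → (r + + 2 * k) + m * k ≡ r + (+ 1 + m) * k + k
    collect = solve-∀
    absorb : ∀ j → + suc j * + (suc m C suc j) * g (r + + 2 * k * + suc j)
                 ≡ + suc m * (+ (m C j) * g ((r + + 2 * k) + + 2 * k * + j))
    absorb j = begin
      + suc j * + (suc m C suc j) * g (r + + 2 * k * + suc j)
        ≡⟨ cong₂ _*_ (trans (sym (pos-* (suc j) _))
                            (trans (cong +_ ([k+1]*[n+1]C[k+1]≡[n+1]*nCk m j)) (pos-* (suc m) _)))
                     (cong g (shift r k (+ j))) ⟩
      + suc m * + (m C j) * g ((r + + 2 * k) + + 2 * k * + j)
        ≡⟨ *-assoc (+ suc m) (+ (m C j)) _ ⟩
      + suc m * (+ (m C j) * g ((r + + 2 * k) + + 2 * k * + j)) ∎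

proposition1 : (n : ℕ) (k r : ℤ) → ∃ (λ m → k ≡ + 2 * m) →
    ((+ 2 * sumTo n (λ j → + j * + (n C j) * L (r + + 2 * k * + j))
        ≡ + 5 * + n * (L k ^ (n ∸ 1)) * F (r + + n * k) * F k
          + + n * (L k ^ n) * L (r + + n * k))
    × (+ 2 * sumTo n (λ j → + j * + (n C j) * F (r + + 2 * k * + j))
        ≡ + n * (L k ^ (n ∸ 1)) * L (r + + n * k) * F k
          + + n * (L k ^ n) * F (r + + n * k)))
proposition1 n k r (m , k≡2m) = L-sum , F-sum
  where
  y = r + + n * k
  P = L k ^ (n ∸ 1)
  regroup : ∀ a b c → + 2 * (a * b * c) ≡ a * b * (+ 2 * c)
  regroup = solve-∀
  L-sum = begin
    + 2 * sumTo n (λ j → + j * + (n C j) * L (r + + 2 * k * + j))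
      ≡⟨ cong (+ 2 *_) (weighted-binomial-sum L k (L k) (k-step-even L m (L k) k≡2m (L-k-step k)) n r) ⟩
    + 2 * (+ n * P * L (y + k))                      ≡⟨ regroup (+ n) P _ ⟩
    + n * P * (+ 2 * L (y + k))                      ≡⟨ cong (+ n * P *_) (L-+ y k) ⟩
    + n * P * (L y * L k + + 5 * F y * F k)          ≡⟨ expand (+ n) P (L y) (L k) (F y) (F k) ⟩
    + 5 * + n * P * F y * F k + + n * P * L k * L y
      ≡⟨ cong (λ t → + 5 * + n * P * F y * F k + t * L y) (sym (n*c^n≡n*c^[n∸1]*c n (L k))) ⟩
    + 5 * + n * P * F y * F k + + n * L k ^ n * L y  ∎
    where expand : ∀ n p a b c d → n * p * (a * b + + 5 * c * d) ≡ + 5 * n * p * c * d + n * p * b * a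
          expand = solve-∀
  F-sum = begin
    + 2 * sumTo n (λ j → + j * + (n C j) * F (r + + 2 * k * + j))
      ≡⟨ cong (+ 2 *_) (weighted-binomial-sum F k (L k) (k-step-even F m (L k) k≡2m (F-k-step k)) n r) ⟩
    + 2 * (+ n * P * F (y + k))                      ≡⟨ regroup (+ n) P _ ⟩
    + n * P * (+ 2 * F (y + k))                      ≡⟨ cong (+ n * P *_) (F-+ y k) ⟩
    + n * P * (F y * L k + L y * F k)                ≡⟨ expand (+ n) P (F y) (L k) (L y) (F k) ⟩
    + n * P * L y * F k + + n * P * L k * F y
      ≡⟨ cong (λ t → + n * P * L y * F k + t * F y) (sym (n*c^n≡n*c^[n∸1]*c n (L k))) ⟩
    + n * P * L y * F k + + n * L k ^ n * F y        ∎
    where expand : ∀ n p a b c d → n * p * (a * b + c * d) ≡ n * p * c * d + n * p * b * a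
          expand = solve-∀
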